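{- Let $k\ge 2$, $n\ge 1$ and let $(a_{i,j})$ be a generic $\mathrm{SL}_k$-frieze pattern of height $n$ over a field $K$. Then it is tame.
   Context: An $\mathrm{SL}_k$-frieze pattern of height $n$ over a field $K$ is a family $(a_{i,j})$ of elements of $K$, indexed by $i\in\mathbb{Z}$ and $i-k\le j\le i+n+k-1$, such that $a_{i,j}=0$ for $i-k\le j\le i-2$ and for $i+n+1\le j\le i+n+k-1$, $a_{i,i-1}=a_{i,i+n}=1$, and (the entries $c_{i,j}:=a_{i,i+j-1}$, $1\le j\le n$, being otherwise arbitrary) for every $i\in\mathbb{Z}$ and every $j$ with $i-1\le j\le i+n$ the $k\times k$ matrix $(a_{r,s})_{i\le r\le i+k-1,\ j\le s\le j+k-1}$ has determinant $1$. For $\ell\ge1$ write $D^\ell_{i,j}=\det (a_{r,s})_{i\le r\le i+\ell-1,\ j\le s\le j+\ell-1}$ whenever all these entries are defined. The pattern is generic if $D^{k-1}_{i,j}\ne 0$ for all $i\in\mathbb{Z}$ and all $j$ with $i\le j\le i+n-1$ (i.e. every adjacent $(k-1)\times(k-1)$ submatrix not containing too many border zeros has nonzero determinant). It is tame if $D^{k+1}_{i,j}=0$ for all $i\in\mathbb{Z}$ and all $j$ with $i\le j\le i+n-1$ (i.e. all complete adjacent $(k+1)\times(k+1)$ submatrices have determinant $0$). -}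

module Defs where

open import Level using (Level; _⊔_) renaming (suc to lsuc)
open import Algebra.Bundles using (CommutativeRing)
open import Data.Nat using (ℕ; zero; suc)
open import Data.Fin using (Fin; zero; suc; toℕ; punchIn)
open import Data.Integer using (ℤ; +_) renaming (_+_ to _+ℤ_; _-_ to _-ℤ_; _≤_ to _≤ℤ_)
open import Data.Product using (Σ; _×_)
open import Relation.Nullary using (¬_)

record Field (c ℓ : Level) : Set (lsuc (c ⊔ ℓ)) where
  field
    commutativeRing : CommutativeRing c ℓ
  open CommutativeRing commutativeRing public
  field
    1≉0     : ¬ (1# ≈ 0#)
    inverse : ∀ x → ¬ (x ≈ 0#) → Σ Carrier (λ y → (x * y) ≈ 1#)

module _ {c ℓ : Level} (R : CommutativeRing c ℓ) where
  open CommutativeRing R using (Carrier; _+_; _*_; -_; 0#; 1#)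

  sumFin : ∀ m → (Fin m → Carrier) → Carrier
  sumFin zero    f = 0#
  sumFin (suc m) f = f zero + sumFin m (λ i → f (suc i))

  sign : ℕ → Carrier
  sign zero    = 1#
  sign (suc m) = - sign m

  det : ∀ m → (Fin m → Fin m → Carrier) → Carrier
  det zero    M = 1#
  det (suc m) M =
    sumFin (suc m) (λ j → (sign (toℕ j) * M zero j)
                          * det m (λ r s → M (suc r) (punchIn j s)))

  D : (ℤ → ℤ → Carrier) → ℕ → ℤ → ℤ → Carrier
  D a m i j = det m (λ r s → a (i +ℤ + toℕ r) (j +ℤ + toℕ s))

module _ {c ℓ : Level} (K : Field c ℓ) where
  open Field K using (Carrier; _≈_; 0#; 1#; commutativeRing)

  -- The family (a_{i,j}) is represented by a total function ℤ → ℤ → K;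
  -- only the values with i-k ≤ j ≤ i+n+k-1 are constrained / used.
  record IsSLFrieze (k n : ℕ) (a : ℤ → ℤ → Carrier) : Set (c ⊔ ℓ) where
    field
      zeros-left  : ∀ i j → i -ℤ + k ≤ℤ j → j ≤ℤ i -ℤ + 2 → a i j ≈ 0#
      zeros-right : ∀ i j → i +ℤ + n +ℤ + 1 ≤ℤ j → j ≤ℤ i +ℤ + n +ℤ + k -ℤ + 1 → a i j ≈ 0#
      ones-left   : ∀ i → a i (i -ℤ + 1) ≈ 1#
      ones-right  : ∀ i → a i (i +ℤ + n) ≈ 1#
      det-one     : ∀ i j → i -ℤ + 1 ≤ℤ j → j ≤ℤ i +ℤ + n →
                    D commutativeRing a k i j ≈ 1#

  IsGeneric : (k n : ℕ) (a : ℤ → ℤ → Carrier) → Set ℓ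
  IsGeneric k n a = ∀ i j → i ≤ℤ j → j ≤ℤ i +ℤ + n -ℤ + 1 →
                    ¬ (D commutativeRing a (Data.Nat._∸_ k 1) i j ≈ 0#)

  IsTame : (k n : ℕ) (a : ℤ → ℤ → Carrier) → Set ℓ
  IsTame k n a = ∀ i j → i ≤ℤ j → j ≤ℤ i +ℤ + n -ℤ + 1 →
                 D commutativeRing a (suc k) i j ≈ 0#

-- For the (k+1)×(k+1) window M of adjacent entries at (i, j), the Desnanot–Jacobi identity
-- det M · c = NW · SE − NE · SW relates det M to its four corner k×k minors and its central (k−1)×(k−1)
-- minor c. In an SL_k-frieze the corners are adjacent k×k minors, so all equal 1, and genericity makes c
-- nonzero; hence det M = 0.
--
-- The identity is proved by clearing the middle entries of the first column of M with a column operation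
-- whose coefficients come from Cramer's rule for the central block: this multiplies det M, NW and SW by c
-- and leaves NE, SE unchanged, and expanding the cleared determinants along the first column leaves two
-- terms each.

module Submission where

open import Defs
open import Level using (Level)
open import Algebra.Bundles using (CommutativeRing)
open import Data.Nat as ℕ using (ℕ; zero; suc; _≤_; s≤s)
open import Data.Nat.Properties using (m≢1+n+m; m∸n+n≡m; suc-injective)
open import Data.Fin using (Fin; zero; suc; toℕ; fromℕ; punchIn; punchOut; inject₁; lower₁; _≟_; _<_)
open import Data.Fin.Properties as Fin
  using (toℕ-injective; toℕ-fromℕ; toℕ-inject₁; inject₁-lower₁; <-cmp;
         punchInᵢ≢i; punchIn-punchOut; punchOut-punchIn; punchOut-cong)
open import Data.Integer using (ℤ)
import Data.Integer as Int
import Data.Integer.Properties as IntP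
open import Data.Integer.Solver using (module +-*-Solver)
open import Data.Maybe using (nothing)
open import Data.Product using (Σ; _×_; _,_)
open import Data.Sum using (_⊎_; inj₁; inj₂)
open import Data.Vec.Functional using (_∷_)
open import Function using (_∘_)
open import Relation.Binary.Definitions using (tri<; tri≈; tri>)
open import Relation.Binary.PropositionalEquality as ≡ using (_≡_; _≢_)
open import Relation.Nullary using (¬_; yes; no; contradiction)

private variable n : ℕ

punchIn-inject₁-suc : (t s : Fin n) → punchIn (inject₁ t) s ≡ punchIn (suc t) s
                      ⊎ (punchIn (inject₁ t) s ≡ suc t × punchIn (suc t) s ≡ inject₁ t)
punchIn-inject₁-suc zero    zero    = inj₂ (≡.refl , ≡.refl)
punchIn-inject₁-suc zero    (suc s) = inj₁ ≡.refl
punchIn-inject₁-suc (suc t) zero    = inj₁ ≡.refl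
punchIn-inject₁-suc (suc t) (suc s) with punchIn-inject₁-suc t s
... | inj₁ eq         = inj₁ (≡.cong suc eq)
... | inj₂ (eq , eq′) = inj₂ (≡.cong suc eq , ≡.cong suc eq′)

punchIn-adjacent : (j : Fin (suc (suc n))) (t : Fin (suc n)) → j ≢ inject₁ t → j ≢ suc t →
                   Σ (Fin n) λ t′ → punchIn j (inject₁ t′) ≡ inject₁ t × punchIn j (suc t′) ≡ suc t
punchIn-adjacent         zero          zero    j≢t _   = contradiction ≡.refl j≢t
punchIn-adjacent         zero          (suc t) _   _   = t , ≡.refl , ≡.refl
punchIn-adjacent         (suc zero)    zero    _   j≢t = contradiction ≡.refl j≢t
punchIn-adjacent {suc n} (suc (suc j)) zero    _   _   = zero , ≡.refl , ≡.refl
punchIn-adjacent {suc n} (suc j)       (suc t) j≢t j≢t′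
  with punchIn-adjacent j t (j≢t ∘ ≡.cong suc) (j≢t′ ∘ ≡.cong suc)
... | t′ , eq , eq′ = suc t′ , ≡.cong suc eq , ≡.cong suc eq′

punchIn-≢ : {j l : Fin (suc n)} (j≢l : j ≢ l) (s : Fin n) → s ≢ punchOut j≢l → punchIn j s ≢ l
punchIn-≢ {j = j} j≢l s s≢ eq = s≢ (≡.trans (≡.sym (punchOut-punchIn j)) (punchOut-cong j eq))

inject₁≢suc : (t : Fin n) → inject₁ t ≢ suc t
inject₁≢suc zero    ()
inject₁≢suc (suc t) eq = inject₁≢suc t (Fin.suc-injective eq)

punchIn-fromℕ : (s : Fin n) → punchIn (fromℕ n) s ≡ inject₁ s
punchIn-fromℕ zero    = ≡.refl
punchIn-fromℕ (suc s) = ≡.cong suc (punchIn-fromℕ s)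

≢fromℕ⇒inject₁ : (i : Fin (suc n)) → i ≢ fromℕ n → Σ (Fin n) λ r → inject₁ r ≡ i
≢fromℕ⇒inject₁ {n} i i≢n = lower₁ i n≢i , inject₁-lower₁ i n≢i
  where
  n≢i : n ≢ toℕ i
  n≢i n≡i = i≢n (toℕ-injective (≡.trans (≡.sym n≡i) (≡.sym (toℕ-fromℕ n))))

module Summation {c ℓ : Level} (R : CommutativeRing c ℓ) where
  open CommutativeRing R hiding (zero)
  open import Algebra.Properties.Semiring.Sum semiring public
  open import Algebra.Properties.AbelianGroup +-abelianGroup using (⁻¹-∙-comm; ε⁻¹≈ε)
  open import Relation.Binary.Reasoning.Setoid setoid

  sumFin≡sum : ∀ m (f : Fin m → Carrier) → sumFin R m f ≡ sum f
  sumFin≡sum zero    f = ≡.refl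
  sumFin≡sum (suc m) f = ≡.cong (f zero +_) (sumFin≡sum m (f ∘ suc))

  sum-zero : ∀ {m} {f : Fin m → Carrier} → (∀ j → f j ≈ 0#) → sum f ≈ 0#
  sum-zero {m} f≈0 = trans (sum-cong-≋ f≈0) (sum-replicate-zero m)

  -‿sum : ∀ {m} (f : Fin m → Carrier) → - sum f ≈ sum (λ j → - f j)
  -‿sum {zero}  f = ε⁻¹≈ε
  -‿sum {suc m} f = trans (sym (⁻¹-∙-comm _ _)) (+-congˡ (-‿sum (f ∘ suc)))

  sum-single : ∀ {m} (f : Fin (suc m) → Carrier) (a : Fin (suc m)) →
               (∀ j → j ≢ a → f j ≈ 0#) → sum f ≈ f a
  sum-single f a others = begin
    sum f                       ≈⟨ sum-remove f ⟩
    f a + sum (f ∘ punchIn a)   ≈⟨ +-congˡ (sum-zero (λ j → others _ (punchInᵢ≢i a j))) ⟩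
    f a + 0#                    ≈⟨ +-identityʳ _ ⟩
    f a                         ∎

  sum-pair : ∀ {m} (f : Fin (suc m) → Carrier) {a b : Fin (suc m)} → (a≢b : a ≢ b) →
             (∀ j → j ≢ a → j ≢ b → f j ≈ 0#) → sum f ≈ f a + f b
  sum-pair {zero} f {zero} {zero} a≢b _ = contradiction ≡.refl a≢b
  sum-pair {suc m} f {a} {b} a≢b others = begin
    sum f                     ≈⟨ sum-remove f ⟩
    f a + sum (f ∘ punchIn a) ≈⟨ +-congˡ (sum-single (f ∘ punchIn a) (punchOut a≢b) rest) ⟩
    f a + f (punchIn a (punchOut a≢b)) ≡⟨ ≡.cong (λ x → f a + f x) (punchIn-punchOut a≢b) ⟩
    f a + f b                 ∎
    where
    rest : ∀ j → j ≢ punchOut a≢b → f (punchIn a j) ≈ 0#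
    rest j j≢ = others _ (punchInᵢ≢i a j) (punchIn-≢ a≢b j j≢)

module Determinant {c ℓ : Level} (R : CommutativeRing c ℓ) where
  open CommutativeRing R hiding (zero)
  open Summation R
  open import Relation.Binary.Reasoning.Setoid setoid
  open import Algebra.Solver.Ring.NaturalCoefficients commutativeSemiring (λ _ _ → nothing)
  open import Algebra.Properties.Ring ring using (-‿distribˡ-*)
  open import Algebra.Properties.Group +-group using (inverseʳ-unique; ⁻¹-involutive; ε⁻¹≈ε; x∙y⁻¹≈ε⇒x≈y)

  Matrix : ℕ → Set c
  Matrix n = Fin n → Fin n → Carrier

  minor : Matrix (suc n) → Fin (suc n) → Matrix n
  minor M j r s = M (suc r) (punchIn j s)

  rowExpansionTerm : Matrix (suc n) → Fin (suc n) → Carrier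
  rowExpansionTerm {n} M j = sign R (toℕ j) * M zero j * det R n (minor M j)

  det-rowExpansion : ∀ n (M : Matrix (suc n)) → det R (suc n) M ≈ sum (rowExpansionTerm M)
  det-rowExpansion n M = reflexive (sumFin≡sum (suc n) (rowExpansionTerm M))

  det-cong : ∀ n {M N : Matrix n} → (∀ r s → M r s ≈ N r s) → det R n M ≈ det R n N
  det-cong zero    _   = refl
  det-cong (suc n) {M} {N} M≈N = begin
    det R (suc n) M           ≈⟨ det-rowExpansion n M ⟩
    sum (rowExpansionTerm M)  ≈⟨ sum-cong-≋ (λ j → *-cong (*-congˡ {sign R (toℕ j)} (M≈N zero j))
                                                        (det-cong n (λ r s → M≈N (suc r) (punchIn j s)))) ⟩
    sum (rowExpansionTerm N)  ≈⟨ det-rowExpansion n N ⟨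
    det R (suc n) N           ∎

  -‿*-assoc³ : ∀ x y z → - x * y * z ≈ - (x * y * z)
  -‿*-assoc³ x y z = trans (*-congʳ (sym (-‿distribˡ-* x y))) (sym (-‿distribˡ-* (x * y) z))

  *-zero-middle : ∀ x {y} z → y ≈ 0# → x * y * z ≈ 0#
  *-zero-middle x z y≈0 = trans (*-congʳ (trans (*-congˡ y≈0) (zeroʳ x))) (zeroˡ z)

  det-linear-column : ∀ n (M M₁ M₂ : Matrix n) (l : Fin n) (x y : Carrier) →
    (∀ r s → s ≢ l → M r s ≈ M₁ r s) → (∀ r s → s ≢ l → M r s ≈ M₂ r s) →
    (∀ r → M r l ≈ x * M₁ r l + y * M₂ r l) →
    det R n M ≈ x * det R n M₁ + y * det R n M₂
  det-linear-column (suc n) M M₁ M₂ l x y M≈M₁ M≈M₂ M≈ = begin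
    det R (suc n) M                              ≈⟨ det-rowExpansion n M ⟩
    sum (rowExpansionTerm M)                     ≈⟨ sum-cong-≋ termwise ⟩
    sum (λ j → x * T₁ j + y * T₂ j)              ≈⟨ ∑-distrib-+ (λ j → x * T₁ j) (λ j → y * T₂ j) ⟩
    sum (λ j → x * T₁ j) + sum (λ j → y * T₂ j)  ≈⟨ +-cong (*-distribˡ-sum x T₁) (*-distribˡ-sum y T₂) ⟨
    x * sum T₁ + y * sum T₂                      ≈⟨ +-cong (*-congˡ (det-rowExpansion n M₁)) (*-congˡ (det-rowExpansion n M₂)) ⟨
    x * det R (suc n) M₁ + y * det R (suc n) M₂  ∎
    where
    T₁ T₂ : Fin (suc n) → Carrier
    T₁ = rowExpansionTerm M₁
    T₂ = rowExpansionTerm M₂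
    termwise : ∀ j → rowExpansionTerm M j ≈ x * T₁ j + y * T₂ j
    termwise j with j ≟ l
    ... | yes ≡.refl = begin
      σ * M zero j * det R n (minor M j)
        ≈⟨ *-cong (*-congˡ (M≈ zero)) (det-cong n (λ r s → M≈M₁ (suc r) _ (punchInᵢ≢i j s))) ⟩
      σ * (x * M₁ zero j + y * M₂ zero j) * det R n (minor M₁ j)
        ≈⟨ solve 6 (λ σ x y a b d → σ :* (x :* a :+ y :* b) :* d := x :* (σ :* a :* d) :+ y :* (σ :* b :* d))
                   refl σ x y (M₁ zero j) (M₂ zero j) (det R n (minor M₁ j)) ⟩
      x * T₁ j + y * (σ * M₂ zero j * det R n (minor M₁ j))
        ≈⟨ +-congˡ (*-congˡ (*-congˡ (det-cong n (λ r s →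
             trans (sym (M≈M₁ (suc r) _ (punchInᵢ≢i j s))) (M≈M₂ (suc r) _ (punchInᵢ≢i j s)))))) ⟩
      x * T₁ j + y * T₂ j ∎
      where
      σ : Carrier
      σ = sign R (toℕ j)
    ... | no j≢l = begin
      σ * M zero j * det R n (minor M j)
        ≈⟨ *-congˡ (det-linear-column n (minor M j) (minor M₁ j) (minor M₂ j) (punchOut j≢l) x y
             (λ r s s≢ → M≈M₁ (suc r) _ (punchIn-≢ j≢l s s≢)) (λ r s s≢ → M≈M₂ (suc r) _ (punchIn-≢ j≢l s s≢))
             (λ r → ≡.subst (λ l′ → M (suc r) l′ ≈ x * M₁ (suc r) l′ + y * M₂ (suc r) l′)
                            (≡.sym (punchIn-punchOut j≢l)) (M≈ (suc r)))) ⟩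
      σ * M zero j * (x * det R n (minor M₁ j) + y * det R n (minor M₂ j))
        ≈⟨ solve 6 (λ σ x y a b d → σ :* a :* (x :* b :+ y :* d) := x :* (σ :* a :* b) :+ y :* (σ :* a :* d))
                   refl σ x y (M zero j) (det R n (minor M₁ j)) (det R n (minor M₂ j)) ⟩
      x * (σ * M zero j * det R n (minor M₁ j)) + y * (σ * M zero j * det R n (minor M₂ j))
        ≈⟨ +-cong (*-congˡ (*-congʳ (*-congˡ (M≈M₁ zero j j≢l)))) (*-congˡ (*-congʳ (*-congˡ (M≈M₂ zero j j≢l)))) ⟩
      x * T₁ j + y * T₂ j ∎
      where
      σ : Carrier
      σ = sign R (toℕ j)

  det-linear-column-+ : ∀ n (M M₁ M₂ : Matrix n) (l : Fin n) →
    (∀ r s → s ≢ l → M r s ≈ M₁ r s) → (∀ r s → s ≢ l → M r s ≈ M₂ r s) →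
    (∀ r → M r l ≈ M₁ r l + M₂ r l) → det R n M ≈ det R n M₁ + det R n M₂
  det-linear-column-+ n M M₁ M₂ l M≈M₁ M≈M₂ M≈ =
    trans (det-linear-column n M M₁ M₂ l 1# 1# M≈M₁ M≈M₂ (λ r → trans (M≈ r) (sym 1*+1*)))
          1*+1*
    where
    1*+1* : ∀ {x y} → 1# * x + 1# * y ≈ x + y
    1*+1* = +-cong (*-identityˡ _) (*-identityˡ _)

  -- Adjacent equal columns: the two cofactor terms at them cancel, all other minors inherit the pair.
  det-adjacent-equal-columns : ∀ n (M : Matrix (suc n)) (t : Fin n) →
    (∀ r → M r (inject₁ t) ≈ M r (suc t)) → det R (suc n) M ≈ 0#
  det-adjacent-equal-columns (suc n) M t columns≈ = begin
    det R (suc (suc n)) M      ≈⟨ det-rowExpansion (suc n) M ⟩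
    sum T                      ≈⟨ sum-pair T (inject₁≢suc t) others ⟩
    T (inject₁ t) + T (suc t)  ≈⟨ +-congʳ (*-cong (*-cong sign≈ (columns≈ zero)) (det-cong (suc n) minors≈)) ⟩
    X + - σ * M zero (suc t) * det R (suc n) (minor M (suc t))
                               ≈⟨ +-congˡ (-‿*-assoc³ σ _ _) ⟩
    X + - X                    ≈⟨ -‿inverseʳ X ⟩
    0#                         ∎
    where
    T : Fin (suc (suc n)) → Carrier
    T = rowExpansionTerm M
    σ X : Carrier
    σ = sign R (toℕ t)
    X = σ * M zero (suc t) * det R (suc n) (minor M (suc t))
    sign≈ : sign R (toℕ (inject₁ t)) ≈ σ
    sign≈ = reflexive (≡.cong (sign R) (toℕ-inject₁ t))
    minors≈ : ∀ r s → minor M (inject₁ t) r s ≈ minor M (suc t) r s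
    minors≈ r s with punchIn-inject₁-suc t s
    ... | inj₁ eq         = reflexive (≡.cong (M (suc r)) eq)
    ... | inj₂ (eq , eq′) = trans (reflexive (≡.cong (M (suc r)) eq))
                                  (trans (sym (columns≈ (suc r))) (reflexive (≡.cong (M (suc r)) (≡.sym eq′))))
    others : ∀ j → j ≢ inject₁ t → j ≢ suc t → T j ≈ 0#
    others j j≢t j≢t′ with punchIn-adjacent j t j≢t j≢t′
    ... | t′ , eq , eq′ = trans (*-congˡ (det-adjacent-equal-columns n (minor M j) t′ λ r →
            ≡.subst₂ (λ u v → M (suc r) u ≈ M (suc r) v) (≡.sym eq) (≡.sym eq′) (columns≈ (suc r)))) (zeroʳ _)

  setColumn : Matrix n → Fin n → (Fin n → Carrier) → Matrix n
  setColumn M l u r s with s ≟ l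
  ... | yes _ = u r
  ... | no  _ = M r s

  setColumn-≡ : ∀ (M : Matrix n) l u r → setColumn M l u r l ≡ u r
  setColumn-≡ M l u r with l ≟ l
  ... | yes _   = ≡.refl
  ... | no  l≢l = contradiction ≡.refl l≢l

  setColumn-≢ : ∀ (M : Matrix n) {l s} u r → s ≢ l → setColumn M l u r s ≡ M r s
  setColumn-≢ M {l} {s} u r s≢l with s ≟ l
  ... | yes s≡l = contradiction s≡l s≢l
  ... | no  _   = ≡.refl

  columnwise : ∀ {M N : Matrix n} {a b : Fin n} → (∀ r → M r a ≈ N r a) → (∀ r → M r b ≈ N r b) →
               (∀ r s → s ≢ a → s ≢ b → M r s ≈ N r s) → ∀ r s → M r s ≈ N r s
  columnwise {a = a} {b} at-a at-b elsewhere r s with s ≟ a | s ≟ b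
  ... | yes ≡.refl | _          = at-a r
  ... | no  _      | yes ≡.refl = at-b r
  ... | no  s≢a    | no  s≢b    = elsewhere r s s≢a s≢b

  setColumns : Matrix n → Fin n → Fin n → (Fin n → Carrier) → (Fin n → Carrier) → Matrix n
  setColumns M a b u v = setColumn (setColumn M a u) b v

  swapColumns : Matrix n → Fin n → Fin n → Matrix n
  swapColumns M a b = setColumns M a b (λ r → M r b) (λ r → M r a)

  module _ (M : Matrix n) {a b : Fin n} (a≢b : a ≢ b) where
    setColumns-a : ∀ u v r → setColumns M a b u v r a ≡ u r
    setColumns-a u v r = ≡.trans (setColumn-≢ _ v r a≢b) (setColumn-≡ M a u r)

    setColumns-b : ∀ u v r → setColumns M a b u v r b ≡ v r
    setColumns-b u v r = setColumn-≡ _ b v r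

    setColumns-≢ : ∀ u v r {s} → s ≢ a → s ≢ b → setColumns M a b u v r s ≡ M r s
    setColumns-≢ u v r s≢a s≢b = ≡.trans (setColumn-≢ _ v r s≢b) (setColumn-≢ M u r s≢a)

    setColumns-self : ∀ r s → setColumns M a b (λ r → M r a) (λ r → M r b) r s ≈ M r s
    setColumns-self = columnwise (λ r → reflexive (setColumns-a _ _ r)) (λ r → reflexive (setColumns-b _ _ r))
                                 (λ r s s≢a s≢b → reflexive (setColumns-≢ _ _ r s≢a s≢b))

    det-setColumns-linearˡ : ∀ u u′ v → det R n (setColumns M a b (λ r → u r + u′ r) v) ≈
                                         det R n (setColumns M a b u v) + det R n (setColumns M a b u′ v)
    det-setColumns-linearˡ u u′ v = det-linear-column-+ n _ _ _ a
      (λ r s s≢a → reflexive (off-a _ u r s s≢a)) (λ r s s≢a → reflexive (off-a _ u′ r s s≢a))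
      (λ r → reflexive (≡.trans (setColumns-a _ v r) (≡.sym (≡.cong₂ _+_ (setColumns-a u v r) (setColumns-a u′ v r)))))
      where
      off-a : ∀ u u′ r s → s ≢ a → setColumns M a b u v r s ≡ setColumns M a b u′ v r s
      off-a u u′ r s s≢a with s ≟ b
      ... | yes _ = ≡.refl
      ... | no  _ = ≡.trans (setColumn-≢ M u r s≢a) (≡.sym (setColumn-≢ M u′ r s≢a))

    det-setColumns-linearʳ : ∀ u v v′ → det R n (setColumns M a b u (λ r → v r + v′ r)) ≈
                                         det R n (setColumns M a b u v) + det R n (setColumns M a b u v′)
    det-setColumns-linearʳ u v v′ = det-linear-column-+ n _ _ _ b
      (λ r s s≢b → reflexive (≡.trans (setColumn-≢ _ _ r s≢b) (≡.sym (setColumn-≢ _ v r s≢b))))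
      (λ r s s≢b → reflexive (≡.trans (setColumn-≢ _ _ r s≢b) (≡.sym (setColumn-≢ _ v′ r s≢b))))
      (λ r → reflexive (≡.trans (setColumns-b u _ r) (≡.sym (≡.cong₂ _+_ (setColumns-b u v r) (setColumns-b u v′ r)))))

  AlternatingAt : ∀ n → Fin n → Fin n → Set (c Level.⊔ ℓ)
  AlternatingAt n a b = ∀ (M : Matrix n) → (∀ r → M r a ≈ M r b) → det R n M ≈ 0#

  -- With B(u, v) the determinant after setting columns a, b to u, v: 0 = B(u+v, u+v) = B(u, v) + B(v, u).
  det-swapColumns : ∀ n (M : Matrix n) {a b : Fin n} → a ≢ b → AlternatingAt n a b →
                    det R n (swapColumns M a b) ≈ - det R n M
  det-swapColumns n M {a} {b} a≢b alternating = inverseʳ-unique (det R n M) _ (begin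
    det R n M + B v u                  ≈⟨ +-cong (det-cong n (setColumns-self M a≢b)) (+-identityʳ _) ⟨
    B u v + (B v u + 0#)               ≈⟨ +-cong (+-identityˡ _) (+-congˡ (alternating-B v)) ⟨
    (0# + B u v) + (B v u + B v v)     ≈⟨ +-congʳ (+-congʳ (alternating-B u)) ⟨
    (B u u + B u v) + (B v u + B v v)  ≈⟨ +-cong (det-setColumns-linearʳ M a≢b u u v) (det-setColumns-linearʳ M a≢b v u v) ⟨
    B u uv + B v uv                    ≈⟨ det-setColumns-linearˡ M a≢b u v uv ⟨
    B uv uv                            ≈⟨ alternating-B uv ⟩
    0#                                 ∎)
    where
    u v uv : Fin n → Carrier
    u r = M r a
    v r = M r b
    uv r = u r + v r
    B : (Fin n → Carrier) → (Fin n → Carrier) → Carrier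
    B x y = det R n (setColumns M a b x y)
    alternating-B : ∀ x → B x x ≈ 0#
    alternating-B x = alternating _ (λ r → reflexive (≡.trans (setColumns-a M a≢b x x r) (≡.sym (setColumns-b M a≢b x x r))))

  -- Induction on the gap d: swapping the second copy with its left neighbour moves it one step closer.
  det-equal-columns-gap : ∀ d (M : Matrix (suc n)) (a : Fin (suc n)) (t : Fin n) →
    toℕ t ≡ d ℕ.+ toℕ a → (∀ r → M r a ≈ M r (suc t)) → det R (suc n) M ≈ 0#
  det-equal-columns-gap zero M a t t≡a columns≈ =
    det-adjacent-equal-columns _ M t (λ r → ≡.subst (λ a → M r a ≈ M r (suc t)) a≡t (columns≈ r))
    where
    a≡t : a ≡ inject₁ t
    a≡t = toℕ-injective (≡.trans (≡.sym t≡a) (≡.sym (toℕ-inject₁ t)))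
  det-equal-columns-gap {suc n} (suc d) M a (suc t) t≡ columns≈ = begin
    det R _ M      ≈⟨ ⁻¹-involutive _ ⟨
    - - det R _ M  ≈⟨ -‿cong (det-swapColumns _ M b⁻≢b (λ N → det-adjacent-equal-columns _ N (suc t))) ⟨
    - det R _ M′   ≈⟨ -‿cong (det-equal-columns-gap d M′ a (inject₁ t) (≡.trans (toℕ-inject₁ t) (suc-injective t≡))
                                                    columns′≈) ⟩
    - 0#           ≈⟨ ε⁻¹≈ε ⟩
    0#             ∎
    where
    b⁻ b : Fin (suc (suc n))
    b⁻ = inject₁ (suc t)
    b = suc (suc t)
    b⁻≢b : b⁻ ≢ b
    b⁻≢b = inject₁≢suc (suc t)
    M′ : Matrix (suc (suc n))
    M′ = swapColumns M b⁻ b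
    a≢b⁻ : a ≢ b⁻
    a≢b⁻ a≡b⁻ = m≢1+n+m (toℕ a) (≡.trans (≡.cong toℕ a≡b⁻) (≡.trans (toℕ-inject₁ (suc t)) t≡))
    a≢b : a ≢ b
    a≢b a≡b = m≢1+n+m (toℕ a) (≡.trans (≡.cong toℕ a≡b) (≡.cong suc t≡))
    columns′≈ : ∀ r → M′ r a ≈ M′ r b⁻
    columns′≈ r = trans (reflexive (setColumns-≢ M b⁻≢b _ _ r a≢b⁻ a≢b))
                        (trans (columns≈ r) (reflexive (≡.sym (setColumns-a M b⁻≢b _ _ r))))

  det-equal-columns-< : ∀ n (M : Matrix n) {a b : Fin n} → a < b → (∀ r → M r a ≈ M r b) → det R n M ≈ 0#
  det-equal-columns-< (suc n) M {a} {suc t} (ℕ.s≤s a≤t) = det-equal-columns-gap _ M a t (≡.sym (m∸n+n≡m a≤t))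

  det-equal-columns : ∀ n (M : Matrix n) {a b : Fin n} → a ≢ b → (∀ r → M r a ≈ M r b) → det R n M ≈ 0#
  det-equal-columns n M {a} {b} a≢b columns≈ with <-cmp a b
  ... | tri< a<b _ _ = det-equal-columns-< n M a<b columns≈
  ... | tri≈ _ a≡b _ = contradiction a≡b a≢b
  ... | tri> _ _ b<a = det-equal-columns-< n M b<a (sym ∘ columns≈)

  columnExpansionTerm : Matrix (suc n) → Fin (suc n) → Carrier
  columnExpansionTerm {n} M i = sign R (toℕ i) * M i zero * det R n (λ r s → M (punchIn i r) (suc s))

  -*-distrib-sum : ∀ {m} x y (f : Fin m → Carrier) → - x * y * sum f ≈ sum (λ i → - (x * y * f i))
  -*-distrib-sum x y f = trans (-‿*-assoc³ x y (sum f)) (trans (-‿cong (*-distribˡ-sum (x * y) f)) (-‿sum (λ i → x * y * f i)))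

  -- Expanding the first row of the minors and exchanging the two sums.
  det-columnExpansion : ∀ n (M : Matrix (suc n)) → det R (suc n) M ≈ sum (columnExpansionTerm M)
  det-columnExpansion zero    M = det-rowExpansion zero M
  det-columnExpansion (suc n) M = trans (det-rowExpansion (suc n) M) (+-congˡ (begin
    sum (λ j → - σ j * M zero (suc j) * det R (suc n) (minor M (suc j)))
      ≈⟨ sum-cong-≋ (λ j → *-congˡ { - σ j * M zero (suc j)} (det-columnExpansion n (minor M (suc j)))) ⟩
    sum (λ j → - σ j * M zero (suc j) * sum (λ i → σ i * M (suc i) zero * Δ i j))
      ≈⟨ sum-cong-≋ (λ j → -*-distrib-sum (σ j) (M zero (suc j)) (λ i → σ i * M (suc i) zero * Δ i j)) ⟩
    sum (λ j → sum (λ i → - (σ j * M zero (suc j) * (σ i * M (suc i) zero * Δ i j))))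
      ≈⟨ sum-cong-≋ (λ j → sum-cong-≋ (λ i → -‿cong (solve 5 (λ x a y b d → x :* a :* (y :* b :* d) := y :* b :* (x :* a :* d))
                                                           refl (σ j) (M zero (suc j)) (σ i) (M (suc i) zero) (Δ i j)))) ⟩
    sum (λ j → sum (λ i → - (σ i * M (suc i) zero * (σ j * M zero (suc j) * Δ i j))))
      ≈⟨ ∑-comm (λ j i → - (σ i * M (suc i) zero * (σ j * M zero (suc j) * Δ i j))) ⟩
    sum (λ i → sum (λ j → - (σ i * M (suc i) zero * (σ j * M zero (suc j) * Δ i j))))
      ≈⟨ sum-cong-≋ (λ i → trans (*-congˡ { - σ i * M (suc i) zero} (det-rowExpansion n (λ r s → M (punchIn (suc i) r) (suc s))))
                                (-*-distrib-sum (σ i) (M (suc i) zero) (λ j → σ j * M zero (suc j) * Δ i j))) ⟨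
    sum (λ i → - σ i * M (suc i) zero * det R (suc n) (λ r s → M (punchIn (suc i) r) (suc s))) ∎))
    where
    σ : ∀ {m} → Fin m → Carrier
    σ i = sign R (toℕ i)
    Δ : Fin (suc n) → Fin (suc n) → Carrier
    Δ i j = det R n (λ r s → M (suc (punchIn i r)) (suc (punchIn j s)))

  det-transpose : ∀ n (M : Matrix n) → det R n (λ r s → M s r) ≈ det R n M
  det-transpose zero    M = refl
  det-transpose (suc n) M = trans (det-rowExpansion n (λ r s → M s r))
    (trans (sum-cong-≋ (λ j → *-congˡ {sign R (toℕ j) * M j zero} (det-transpose n (λ r s → M (punchIn j r) (suc s)))))
           (sym (det-columnExpansion n M)))

  det-equal-rows : ∀ n (M : Matrix n) {a b : Fin n} → a ≢ b → (∀ s → M a s ≈ M b s) → det R n M ≈ 0#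
  det-equal-rows n M a≢b rows≈ = trans (sym (det-transpose n M)) (det-equal-columns n _ a≢b rows≈)

  det-firstColumn-single : ∀ n (M : Matrix (suc n)) (a : Fin (suc n)) → (∀ i → i ≢ a → M i zero ≈ 0#) →
    det R (suc n) M ≈ columnExpansionTerm M a
  det-firstColumn-single n M a vanishes = trans (det-columnExpansion n M)
    (sum-single (columnExpansionTerm M) a (λ i i≢a → *-zero-middle _ _ (vanishes i i≢a)))

  det-firstColumn-pair : ∀ n (M : Matrix (suc n)) {a b : Fin (suc n)} → a ≢ b →
    (∀ i → i ≢ a → i ≢ b → M i zero ≈ 0#) → det R (suc n) M ≈ columnExpansionTerm M a + columnExpansionTerm M b
  det-firstColumn-pair n M a≢b vanishes = trans (det-columnExpansion n M)
    (sum-pair (columnExpansionTerm M) a≢b (λ i i≢a i≢b → *-zero-middle _ _ (vanishes i i≢a i≢b)))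

  det-columnOperation : ∀ n k (M M′ : Matrix n) (l : Fin n) (π : Fin k → Fin n) (q : Carrier) (z : Fin k → Carrier) →
    (∀ t → π t ≢ l) → (∀ r s → s ≢ l → M′ r s ≈ M r s) →
    (∀ r → M′ r l ≈ q * M r l + sum (λ t → z t * M r (π t))) → det R n M′ ≈ q * det R n M
  det-columnOperation n zero M M′ l π q z _ elsewhere at-l = begin
    det R n M′                   ≈⟨ det-linear-column n M′ M M l q 0# elsewhere elsewhere
                                      (λ r → trans (at-l r) (+-congˡ (sym (zeroˡ _)))) ⟩
    q * det R n M + 0# * det R n M ≈⟨ +-congˡ (zeroˡ _) ⟩
    q * det R n M + 0#           ≈⟨ +-identityʳ _ ⟩
    q * det R n M                ∎
  det-columnOperation n (suc k) M M′ l π q z π≢l elsewhere at-l = begin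
    det R n M′                              ≈⟨ det-linear-column n M′ M″ N l 1# (z zero)
                                                 (λ r s s≢l → reflexive (≡.sym (setColumn-≢ M′ _ r s≢l)))
                                                 (λ r s s≢l → trans (elsewhere r s s≢l) (reflexive (≡.sym (setColumn-≢ M _ r s≢l))))
                                                 at-l′ ⟩
    1# * det R n M″ + z zero * det R n N    ≈⟨ +-cong (*-identityˡ _) (*-congˡ N-vanishes) ⟩
    det R n M″ + z zero * 0#                 ≈⟨ +-cong M″-scaled (zeroʳ _) ⟩
    q * det R n M + 0#                       ≈⟨ +-identityʳ _ ⟩
    q * det R n M                            ∎
    where
    rest : Fin n → Carrier
    rest r = sum (λ t → z (suc t) * M r (π (suc t)))
    M″ N : Matrix n
    M″ = setColumn M′ l (λ r → q * M r l + rest r)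
    N = setColumn M l (λ r → M r (π zero))
    M″-scaled : det R n M″ ≈ q * det R n M
    M″-scaled = det-columnOperation n k M M″ l (π ∘ suc) q (z ∘ suc) (π≢l ∘ suc)
      (λ r s s≢l → trans (reflexive (setColumn-≢ M′ _ r s≢l)) (elsewhere r s s≢l))
      (λ r → reflexive (setColumn-≡ M′ l _ r))
    N-vanishes : det R n N ≈ 0#
    N-vanishes = det-equal-columns n N (λ l≡π → π≢l zero (≡.sym l≡π))
      (λ r → reflexive (≡.trans (setColumn-≡ M l _ r) (≡.sym (setColumn-≢ M _ r (π≢l zero)))))
    at-l′ : ∀ r → M′ r l ≈ 1# * M″ r l + z zero * N r l
    at-l′ r = begin
      M′ r l ≈⟨ at-l r ⟩
      q * M r l + (z zero * M r (π zero) + rest r)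
        ≈⟨ solve 3 (λ x y u → x :+ (y :+ u) := con 1 :* (x :+ u) :+ y) refl (q * M r l) (z zero * M r (π zero)) (rest r) ⟩
      1# * (q * M r l + rest r) + z zero * M r (π zero)
        ≈⟨ +-cong (*-congˡ (reflexive (≡.sym (setColumn-≡ M′ l _ r))))
                  (*-congˡ (reflexive (≡.sym (setColumn-≡ M l _ r)))) ⟩
      1# * M″ r l + z zero * N r l ∎

  cramerVector : Matrix n → (Fin n → Carrier) → Fin n → Carrier
  cramerVector {n} C x s = sign R (toℕ s) * det R n (λ r t → (x r ∷ C r) (punchIn (suc s) t))

  -- The bordered matrix with rows (x r′, C r′), topped by a copy of row r, has determinant 0; expanding it
  -- along the top row gives the identity.
  cramer : ∀ n (C : Matrix n) (x : Fin n → Carrier) r → sum (λ s → C r s * cramerVector C x s) ≈ det R n C * x r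
  cramer n C x r = sym (x∙y⁻¹≈ε⇒x≈y _ _ (begin
    det R n C * x r + - sum (λ s → C r s * cramerVector C x s)
      ≈⟨ +-cong (trans (*-comm _ _) (*-congʳ (sym (*-identityˡ _))))
                (trans (-‿sum (λ s → C r s * cramerVector C x s)) (sum-cong-≋ rearranged)) ⟩
    sum (rowExpansionTerm W)  ≈⟨ det-rowExpansion n W ⟨
    det R (suc n) W           ≈⟨ det-equal-rows (suc n) W {zero} {suc r} (λ ()) (λ s → refl) ⟩
    0#                        ∎))
    where
    W : Matrix (suc n)
    W zero     = x r ∷ C r
    W (suc r′) = x r′ ∷ C r′
    rearranged : ∀ s → - (C r s * cramerVector C x s) ≈ rowExpansionTerm W (suc s)
    rearranged s = trans (-‿cong (solve 3 (λ a σ d → a :* (σ :* d) := σ :* a :* d) refl (C r s) (sign R (toℕ s)) _))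
                         (sym (-‿*-assoc³ _ _ _))

  module _ {m : ℕ} where
    northWest northEast southWest southEast : Matrix (suc (suc m)) → Carrier
    northWest M = det R (suc m) (λ r s → M (inject₁ r) (inject₁ s))
    northEast M = det R (suc m) (λ r s → M (inject₁ r) (suc s))
    southWest M = det R (suc m) (λ r s → M (suc r) (inject₁ s))
    southEast M = det R (suc m) (λ r s → M (suc r) (suc s))

    centre : Matrix (suc (suc m)) → Carrier
    centre M = det R m (λ r s → M (suc (inject₁ r)) (suc (inject₁ s)))

module DesnanotJacobi {c ℓ : Level} (R : CommutativeRing c ℓ) {m : ℕ} (M : Determinant.Matrix R (suc (suc m))) where
  open CommutativeRing R hiding (zero)
  open Summation R
  open Determinant R
  open import Relation.Binary.Reasoning.Setoid setoid
  open import Algebra.Solver.Ring.NaturalCoefficients commutativeSemiring (λ _ _ → nothing)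
  open import Algebra.Properties.Ring ring using (-‿distribˡ-*; -‿distribʳ-*)

  p : Carrier
  p = centre M

  middle : Fin m → Fin (suc (suc m))
  middle t = suc (inject₁ t)

  bottom : Fin (suc (suc m))
  bottom = fromℕ (suc m)

  middle-row : ∀ i → i ≢ zero → i ≢ bottom → Σ (Fin m) λ t → middle t ≡ i
  middle-row zero    i≢0 _     = contradiction ≡.refl i≢0
  middle-row (suc i) _   i≢bot with ≢fromℕ⇒inject₁ i (i≢bot ∘ ≡.cong suc)
  ... | t , t≡i = t , ≡.cong suc t≡i

  -- ξ is chosen by Cramer's rule so that the new first column vanishes in all middle rows.
  ξ : Fin m → Carrier
  ξ = cramerVector (λ r s → M (middle r) (middle s)) (λ t → M (middle t) zero)

  clearedColumn : Fin (suc (suc m)) → Carrier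
  clearedColumn r = p * M r zero + sum (λ t → - ξ t * M r (middle t))

  cleared : Matrix (suc (suc m))
  cleared = setColumn M zero clearedColumn

  cleared-elsewhere : ∀ r s → s ≢ zero → cleared r s ≡ M r s
  cleared-elsewhere r s s≢0 = setColumn-≢ M clearedColumn r s≢0

  cleared-vanishes : ∀ t → cleared (middle t) zero ≈ 0#
  cleared-vanishes t = begin
    cleared (middle t) zero    ≡⟨ setColumn-≡ M zero clearedColumn (middle t) ⟩
    x + sum (λ s → - ξ s * M (middle t) (middle s))
      ≈⟨ +-congˡ (sum-cong-≋ (λ s → trans (sym (-‿distribˡ-* (ξ s) _)) (-‿cong (*-comm (ξ s) _)))) ⟩
    x + sum (λ s → - (M (middle t) (middle s) * ξ s))
      ≈⟨ +-congˡ (-‿sum (λ s → M (middle t) (middle s) * ξ s)) ⟨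
    x + - sum (λ s → M (middle t) (middle s) * ξ s)
      ≈⟨ +-congˡ (-‿cong (cramer m _ _ t)) ⟩
    x + - x                    ≈⟨ -‿inverseʳ x ⟩
    0#                         ∎
    where
    x : Carrier
    x = p * M (middle t) zero

  det-cleared : det R (suc (suc m)) cleared ≈ p * det R (suc (suc m)) M
  det-cleared = det-columnOperation _ m M cleared zero middle p (λ t → - ξ t) (λ t ())
    (λ r s s≢0 → reflexive (cleared-elsewhere r s s≢0)) (λ r → reflexive (setColumn-≡ M zero clearedColumn r))

  window-cleared : (ρ : Fin (suc m) → Fin (suc (suc m))) →
    det R (suc m) (λ r s → cleared (ρ r) (inject₁ s)) ≈ p * det R (suc m) (λ r s → M (ρ r) (inject₁ s))
  window-cleared ρ = det-columnOperation _ m _ _ zero suc p (λ t → - ξ t) (λ t ())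
    (λ r s s≢0 → reflexive (cleared-elsewhere (ρ r) (inject₁ s) (s≢0 ∘ inject₁≡zero s)))
    (λ r → reflexive (setColumn-≡ M zero clearedColumn (ρ r)))
    where
    inject₁≡zero : (s : Fin (suc m)) → inject₁ s ≡ zero → s ≡ zero
    inject₁≡zero zero _ = ≡.refl

  centre-cleared : centre cleared ≈ p
  centre-cleared = det-cong m (λ r s → reflexive (cleared-elsewhere (middle r) (middle s) (λ ())))

  east-cleared : (ρ : Fin (suc m) → Fin (suc (suc m))) →
    det R (suc m) (λ r s → cleared (ρ r) (suc s)) ≈ det R (suc m) (λ r s → M (ρ r) (suc s))
  east-cleared ρ = det-cong (suc m) (λ r s → reflexive (cleared-elsewhere (ρ r) (suc s) (λ ())))

  northWest-expansion : northWest cleared ≈ cleared zero zero * p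
  northWest-expansion = begin
    northWest cleared         ≈⟨ det-firstColumn-single m (λ r s → cleared (inject₁ r) (inject₁ s)) zero vanishes ⟩
    1# * cleared zero zero * centre cleared  ≈⟨ *-cong (*-identityˡ _) centre-cleared ⟩
    cleared zero zero * p     ∎
    where
    vanishes : ∀ i → i ≢ zero → cleared (inject₁ i) zero ≈ 0#
    vanishes zero    0≢0 = contradiction ≡.refl 0≢0
    vanishes (suc t) _   = cleared-vanishes t

  southWest-expansion : southWest cleared ≈ sign R m * cleared bottom zero * p
  southWest-expansion = begin
    southWest cleared         ≈⟨ det-firstColumn-single m (λ r s → cleared (suc r) (inject₁ s)) (fromℕ m) vanishes ⟩
    sign R (toℕ (fromℕ m)) * cleared bottom zero * det R m (λ r s → cleared (suc (punchIn (fromℕ m) r)) (suc (inject₁ s)))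
      ≈⟨ *-cong (*-congʳ (reflexive (≡.cong (sign R) (toℕ-fromℕ m))))
                (trans (det-cong m (λ r s → reflexive (≡.cong (λ i → cleared (suc i) (suc (inject₁ s))) (punchIn-fromℕ r))))
                       centre-cleared) ⟩
    sign R m * cleared bottom zero * p ∎
    where
    vanishes : ∀ i → i ≢ fromℕ m → cleared (suc i) zero ≈ 0#
    vanishes i i≢m with ≢fromℕ⇒inject₁ i i≢m
    ... | t , ≡.refl = cleared-vanishes t

  det-cleared-expansion : det R (suc (suc m)) cleared ≈
                          cleared zero zero * southEast M + - (sign R m * cleared bottom zero * northEast M)
  det-cleared-expansion = begin
    det R (suc (suc m)) cleared  ≈⟨ det-firstColumn-pair (suc m) cleared (λ ()) vanishes ⟩
    1# * cleared zero zero * southEast cleared +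
      sign R (toℕ bottom) * cleared bottom zero * det R (suc m) (λ r s → cleared (punchIn bottom r) (suc s))
      ≈⟨ +-cong (*-cong (*-identityˡ _) (east-cleared suc))
                (*-cong (*-congʳ (reflexive (≡.cong (sign R) (toℕ-fromℕ (suc m)))))
                        (trans (det-cong (suc m) (λ r s → reflexive (≡.cong (λ i → cleared i (suc s)) (punchIn-fromℕ r))))
                               (east-cleared inject₁))) ⟩
    cleared zero zero * southEast M + - sign R m * cleared bottom zero * northEast M
      ≈⟨ +-congˡ (-‿*-assoc³ _ _ _) ⟩
    cleared zero zero * southEast M + - (sign R m * cleared bottom zero * northEast M) ∎
    where
    vanishes : ∀ i → i ≢ zero → i ≢ bottom → cleared i zero ≈ 0#
    vanishes i i≢0 i≢bot with middle-row i i≢0 i≢bot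
    ... | t , ≡.refl = cleared-vanishes t

  -- Desnanot–Jacobi identity det M · p = NW · SE − NE · SW, multiplied once more by p and with both sides moved so
  -- that no subtraction occurs.
  desnanot-jacobi : p * (p * det R (suc (suc m)) M) + p * (northEast M * southWest M) ≈ p * (northWest M * southEast M)
  desnanot-jacobi = begin
    p * (p * det R _ M) + p * (NE * SW)
      ≈⟨ +-cong (*-congˡ (trans (sym det-cleared) det-cleared-expansion))
                (solve 3 (λ p x y → p :* (x :* y) := x :* (p :* y)) refl p NE SW) ⟩
    p * (a * SE + - Z) + NE * (p * SW)
      ≈⟨ +-cong (trans (distribˡ p _ _) (+-congˡ (sym (-‿distribʳ-* p Z)))) (*-congˡ p*SW) ⟩
    (p * (a * SE) + - (p * Z)) + NE * (σ * b * p)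
      ≈⟨ +-assoc _ _ _ ⟩
    p * (a * SE) + (- (p * Z) + NE * (σ * b * p))
      ≈⟨ +-congˡ (+-congʳ (-‿cong (solve 4 (λ p σ b x → p :* (σ :* b :* x) := x :* (σ :* b :* p)) refl p σ b NE))) ⟩
    p * (a * SE) + (- W + W)  ≈⟨ +-congˡ (-‿inverseˡ W) ⟩
    p * (a * SE) + 0#         ≈⟨ +-identityʳ _ ⟩
    p * (a * SE)              ≈⟨ solve 3 (λ p a x → p :* (a :* x) := (a :* p) :* x) refl p a SE ⟩
    (a * p) * SE              ≈⟨ *-congʳ (trans (sym northWest-expansion) (window-cleared inject₁)) ⟩
    (p * NW) * SE             ≈⟨ *-assoc p NW SE ⟩
    p * (NW * SE)             ∎
    where
    NW NE SW SE a b σ Z W : Carrier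
    NW = northWest M
    NE = northEast M
    SW = southWest M
    SE = southEast M
    a = cleared zero zero
    b = cleared bottom zero
    σ = sign R m
    Z = σ * b * NE
    W = NE * (σ * b * p)
    p*SW : p * SW ≈ σ * b * p
    p*SW = trans (sym (window-cleared suc)) southWest-expansion

module Window {c ℓ : Level} (R : CommutativeRing c ℓ) (a : ℤ → ℤ → CommutativeRing.Carrier R) (i j : ℤ) {m : ℕ} where
  open Int using (+_) renaming (_+_ to _+ℤ_)
  open CommutativeRing R hiding (zero)
  open Determinant R

  window : Matrix (suc (suc m))
  window r s = a (i +ℤ + toℕ r) (j +ℤ + toℕ s)

  +toℕ-inject₁ : ∀ {n} x (r : Fin n) → x +ℤ + toℕ (inject₁ r) ≡ x +ℤ + toℕ r
  +toℕ-inject₁ x r = ≡.cong (λ t → x +ℤ + t) (toℕ-inject₁ r)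

  +toℕ-suc : ∀ {n} x (r : Fin n) → x +ℤ + toℕ (suc r) ≡ (x +ℤ + 1) +ℤ + toℕ r
  +toℕ-suc x r = ≡.sym (IntP.+-assoc x (+ 1) (+ toℕ r))

  subwindow : ∀ {n} (ρ κ : Fin n → Fin (suc (suc m))) (i′ j′ : ℤ) →
    (∀ r → i +ℤ + toℕ (ρ r) ≡ i′ +ℤ + toℕ r) → (∀ s → j +ℤ + toℕ (κ s) ≡ j′ +ℤ + toℕ s) →
    det R n (λ r s → window (ρ r) (κ s)) ≈ D R a n i′ j′
  subwindow ρ κ _ _ ρ≡ κ≡ = det-cong _ (λ r s → reflexive (≡.cong₂ a (ρ≡ r) (κ≡ s)))

  northWest-window : northWest window ≈ D R a (suc m) i j
  northWest-window = subwindow inject₁ inject₁ i j (+toℕ-inject₁ i) (+toℕ-inject₁ j)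

  northEast-window : northEast window ≈ D R a (suc m) i (j +ℤ + 1)
  northEast-window = subwindow inject₁ suc i (j +ℤ + 1) (+toℕ-inject₁ i) (+toℕ-suc j)

  southWest-window : southWest window ≈ D R a (suc m) (i +ℤ + 1) j
  southWest-window = subwindow suc inject₁ (i +ℤ + 1) j (+toℕ-suc i) (+toℕ-inject₁ j)

  southEast-window : southEast window ≈ D R a (suc m) (i +ℤ + 1) (j +ℤ + 1)
  southEast-window = subwindow suc suc (i +ℤ + 1) (j +ℤ + 1) (+toℕ-suc i) (+toℕ-suc j)

  centre-window : centre window ≈ D R a m (i +ℤ + 1) (j +ℤ + 1)
  centre-window = subwindow (suc ∘ inject₁) (suc ∘ inject₁) (i +ℤ + 1) (j +ℤ + 1)
    (λ r → ≡.trans (+toℕ-suc i (inject₁ r)) (+toℕ-inject₁ (i +ℤ + 1) r))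
    (λ s → ≡.trans (+toℕ-suc j (inject₁ s)) (+toℕ-inject₁ (j +ℤ + 1) s))

module Bounds {n : ℕ} {i j : ℤ} (i≤j : Int._≤_ i j) (j≤ : Int._≤_ j (i Int.+ Int.+ n Int.- Int.+ 1)) where
  open Int using (+_) renaming (_+_ to _+ℤ_; _-_ to _-ℤ_; _≤_ to _≤ℤ_)
  open +-*-Solver

  i+1-1≡i : i +ℤ + 1 -ℤ + 1 ≡ i
  i+1-1≡i = solve 1 (λ i → i :+ con (+ 1) :- con (+ 1) := i) ≡.refl i

  j+1≤i+n : j +ℤ + 1 ≤ℤ i +ℤ + n
  j+1≤i+n = IntP.≤-trans (IntP.+-monoˡ-≤ (+ 1) j≤)
                      (IntP.≤-reflexive (solve 2 (λ i n → i :+ n :- con (+ 1) :+ con (+ 1) := i :+ n) ≡.refl i (+ n)))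

  i+n≤i+1+n : i +ℤ + n ≤ℤ i +ℤ + 1 +ℤ + n
  i+n≤i+1+n = IntP.≤-trans (IntP.i≤i+j (i +ℤ + n) (+ 1))
                        (IntP.≤-reflexive (solve 2 (λ i n → i :+ n :+ con (+ 1) := i :+ con (+ 1) :+ n) ≡.refl i (+ n)))

  i-1≤j : i -ℤ + 1 ≤ℤ j
  i-1≤j = IntP.i≤j⇒i-k≤j (+ 1) i≤j

  j≤i+n : j ≤ℤ i +ℤ + n
  j≤i+n = IntP.≤-trans (IntP.i≤i+j j (+ 1)) j+1≤i+n

  i-1≤j+1 : i -ℤ + 1 ≤ℤ j +ℤ + 1
  i-1≤j+1 = IntP.≤-trans i-1≤j (IntP.i≤i+j j (+ 1))

  i+1-1≤j : i +ℤ + 1 -ℤ + 1 ≤ℤ j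
  i+1-1≤j = IntP.≤-trans (IntP.≤-reflexive i+1-1≡i) i≤j

  i+1-1≤j+1 : i +ℤ + 1 -ℤ + 1 ≤ℤ j +ℤ + 1
  i+1-1≤j+1 = IntP.≤-trans i+1-1≤j (IntP.i≤i+j j (+ 1))

  j≤i+1+n : j ≤ℤ i +ℤ + 1 +ℤ + n
  j≤i+1+n = IntP.≤-trans j≤i+n i+n≤i+1+n

  j+1≤i+1+n : j +ℤ + 1 ≤ℤ i +ℤ + 1 +ℤ + n
  j+1≤i+1+n = IntP.≤-trans j+1≤i+n i+n≤i+1+n

  i+1≤j+1 : i +ℤ + 1 ≤ℤ j +ℤ + 1
  i+1≤j+1 = IntP.+-monoˡ-≤ (+ 1) i≤j

  j+1≤i+1+n-1 : j +ℤ + 1 ≤ℤ i +ℤ + 1 +ℤ + n -ℤ + 1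
  j+1≤i+1+n-1 = IntP.≤-trans j+1≤i+n
    (IntP.≤-reflexive (solve 2 (λ i n → i :+ n := i :+ con (+ 1) :+ n :- con (+ 1)) ≡.refl i (+ n)))

module _ {c ℓ : Level} (K : Field c ℓ) where
  open Field K
  open import Relation.Binary.Reasoning.Setoid setoid

  x*y≈0⇒y≈0 : ∀ {x y} → ¬ x ≈ 0# → x * y ≈ 0# → y ≈ 0#
  x*y≈0⇒y≈0 {x} {y} x≉0 xy≈0 with inverse x x≉0
  ... | x⁻¹ , xx⁻¹≈1 = begin
    y              ≈⟨ *-identityˡ y ⟨
    1# * y         ≈⟨ *-congʳ (trans (*-comm x⁻¹ x) xx⁻¹≈1) ⟨
    (x⁻¹ * x) * y  ≈⟨ *-assoc x⁻¹ x y ⟩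
    x⁻¹ * (x * y)  ≈⟨ *-congˡ xy≈0 ⟩
    x⁻¹ * 0#       ≈⟨ zeroʳ x⁻¹ ⟩
    0#             ∎

corollary2p3 : {c ℓ : Level} (K : Field c ℓ) (k n : ℕ) → 2 ≤ k → 1 ≤ n →
    (a : ℤ → ℤ → Field.Carrier K) →
    IsSLFrieze K k n a → IsGeneric K k n a → IsTame K k n a
corollary2p3 K (suc m) n (s≤s _) _ a frieze generic i j i≤j j≤ =
  x*y≈0⇒y≈0 K p≉0 (x*y≈0⇒y≈0 K p≉0 (+-identityˡ-unique _ _ (begin
    p * (p * det commutativeRing (suc (suc m)) window) + p * (1# * 1#)
      ≈⟨ +-congˡ (*-congˡ (*-cong (trans northEast-window (det-one i (j +ℤ + 1) i-1≤j+1 j+1≤i+n))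
                                  (trans southWest-window (det-one (i +ℤ + 1) j i+1-1≤j j≤i+1+n)))) ⟨
    p * (p * det commutativeRing (suc (suc m)) window) + p * (northEast window * southWest window)
      ≈⟨ desnanot-jacobi ⟩
    p * (northWest window * southEast window)
      ≈⟨ *-congˡ (*-cong (trans northWest-window (det-one i j i-1≤j j≤i+n))
                         (trans southEast-window (det-one (i +ℤ + 1) (j +ℤ + 1) i+1-1≤j+1 j+1≤i+1+n))) ⟩
    p * (1# * 1#) ∎)))
  where
  open Field K
  open Int using (+_) renaming (_+_ to _+ℤ_)
  open IsSLFrieze frieze
  open Determinant commutativeRing using (northWest; northEast; southWest; southEast)
  open Window commutativeRing a i j {m}
  open DesnanotJacobi commutativeRing window using (p; desnanot-jacobi)
  open Bounds i≤j j≤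
  open import Relation.Binary.Reasoning.Setoid setoid
  open import Algebra.Properties.Ring ring using (+-identityˡ-unique)
  p≉0 : ¬ p ≈ 0#
  p≉0 p≈0 = generic (i +ℤ + 1) (j +ℤ + 1) i+1≤j+1 j+1≤i+1+n-1 (trans (sym centre-window) p≈0)
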